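{- In any $\mathbf{QBDi3}$-model $\langle W,\le,D,V\rangle$ and for every $w\in W$: (i) there is no sentence $A(\vec d)\in\mathsf{Sent}_{\mathbf D}$ with $\vec d\in D(w)$ such that both $1\in I(w,A(\vec d))$ and $0\in I(w,A(\vec d))$; (ii) for every sentence $A(\vec d)\in\mathsf{Sent}_{\mathbf D}$ with $\vec d\in D(w)$ and every $x\ge w$ there exists $y\ge x$ such that $1\in I(y,A(\vec d))$ or $0\in I(y,A(\vec d))$.
   Context: $\mathcal{L}_Q$: first-order language with $\bot,{\sim},\land,\lor,\to,\forall,\exists$, a countable set $\mathsf{Con}$ of constants and predicate symbols; $\neg A:=A\to\bot$. A $\mathbf{QBDi3}$-model is $\langle W,\le,D,V\rangle$: $W$ a nonempty set; $\le$ a partial order on $W$ such that every $w$ has a maximal successor (some $x\ge w$ with $y\ge x\Rightarrow y=x$); $D(w)\supseteq\mathsf{Con}$ for each $w$, with $D(w)\subseteq D(x)$ when $w\le x$; for each $n$-ary predicate $P$ and $w$, sets $V^+(w,P),V^-(w,P)\subseteq D(w)^n$ with $V^+(w,P)\cap V^-(w,P)=\emptyset$, each monotone ($\vec d\in V^\pm(w,P)$ and $w\le x$ imply $\vec d\in V^\pm(x,P)$), and potentially omniscient (for all $w$, $\vec d\in D(w)^n$ and $x\ge w$ there is $y\ge x$ with $\vec d\in V^+(y,P)\cup V^-(y,P)$). $\mathbf D=\bigcup_w D(w)$ and $\mathsf{Sent}_{\mathbf D}$ is the set of sentences with parameters from $\mathbf D$. $I(w,A)\subseteq\{0,1\}$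 is given by: $1\in I(w,P(\vec d))$ iff $\vec d\in V^+(w,P)$; $0\in I(w,P(\vec d))$ iff $\vec d\in V^-(w,P)$; $1\notin I(w,\bot)$, $0\in I(w,\bot)$; $1\in I(w,{\sim}A)$ iff $0\in I(w,A)$; $0\in I(w,{\sim}A)$ iff $1\in I(w,A)$; $1\in I(w,A\land B)$ iff both $1\in I(w,A)$ and $1\in I(w,B)$; $0\in I(w,A\land B)$ iff $0\in I(w,A)$ or $0\in I(w,B)$; $1\in I(w,A\lor B)$ iff $1\in I(w,A)$ or $1\in I(w,B)$; $0\in I(w,A\lor B)$ iff $0\in I(w,A)$ and $0\in I(w,B)$; $1\in I(w,A\to B)$ iff for all $x\ge w$, $1\notin I(x,A)$ or $1\in I(x,B)$; $0\in I(w,A\to B)$ iff ($0\notin I(x,A)$ for all $x\ge w$) and $0\in I(w,B)$; $1\in I(w,\forall xA)$ iff for all $x\ge w$ and all $d\in D(x)$, $1\in I(x,A(d))$; $0\in I(w,\forall xA)$ iff $0\in I(w,A(d))$ for some $d\in D(w)$; $1\in I(w,\exists xA)$ iff $1\in I(w,A(d))$ for some $d\in D(w)$; $0\in I(w,\exists xA)$ iff for all $x\ge w$ and all $d\in D(x)$, $0\in I(x,A(d))$. -}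

module Defs where

open import Data.Nat using (ℕ; suc)
open import Data.Fin using (Fin)
open import Data.Vec using (Vec; []; _∷_; lookup; map)
open import Data.Vec.Relation.Unary.All using (All)
open import Data.Product using (Σ; _×_; _,_)
open import Data.Sum using (_⊎_)
open import Data.Empty using (⊥)
open import Data.Unit using (⊤)
open import Function.Definitions using (Injective)
open import Relation.Binary.PropositionalEquality using (_≡_)
open import Relation.Nullary using (¬_)

record Signature : Set₁ where
  field
    Con            : Set
    Pred           : Set
    arity          : Pred → ℕ
    Con-countable  : Σ (Con → ℕ) λ f → Injective _≡_ _≡_ f
    Pred-countable : Σ (Pred → ℕ) λ f → Injective _≡_ _≡_ f

module _ (S : Signature) where
  open Signature S

  data Term (X : Set) (n : ℕ) : Set where
    var : Fin n → Term X n
    cst : Con → Term X n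
    par : X → Term X n

  data Form (X : Set) (n : ℕ) : Set where
    atom  : (P : Pred) → Vec (Term X n) (arity P) → Form X n
    ⊥'    : Form X n
    ∼_    : Form X n → Form X n
    _∧'_  : Form X n → Form X n → Form X n
    _∨'_  : Form X n → Form X n → Form X n
    _⇒_   : Form X n → Form X n → Form X n
    all   : Form X (suc n) → Form X n
    ex    : Form X (suc n) → Form X n

  Sent : Set → Set
  Sent X = Form X 0

  TermParamsIn : {X : Set} {n : ℕ} → (X → Set) → Term X n → Set
  TermParamsIn Q (var i) = ⊤
  TermParamsIn Q (cst c) = ⊤
  TermParamsIn Q (par d) = Q d

  ParamsIn : {X : Set} {n : ℕ} → (X → Set) → Form X n → Set
  ParamsIn Q (atom P ts) = All (TermParamsIn Q) ts
  ParamsIn Q ⊥'          = ⊤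
  ParamsIn Q (∼ A)       = ParamsIn Q A
  ParamsIn Q (A ∧' B)    = ParamsIn Q A × ParamsIn Q B
  ParamsIn Q (A ∨' B)    = ParamsIn Q A × ParamsIn Q B
  ParamsIn Q (A ⇒ B)     = ParamsIn Q A × ParamsIn Q B
  ParamsIn Q (all A)     = ParamsIn Q A
  ParamsIn Q (ex A)      = ParamsIn Q A

  record Model : Set₁ where
    field
      W        : Set
      _≤_      : W → W → Set
      ≤-refl   : ∀ w → w ≤ w
      ≤-trans  : ∀ {u v w} → u ≤ v → v ≤ w → u ≤ w
      ≤-antisym : ∀ {u v} → u ≤ v → v ≤ u → u ≡ v
      maxSucc  : ∀ w → Σ W λ x → w ≤ x × (∀ y → x ≤ y → y ≡ x)
      -- 𝐃, the union of all domains; D w is the domain of w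
      Dom      : Set
      D        : W → Dom → Set
      con      : Con → Dom
      con-in   : ∀ w c → D w (con c)
      D-mono   : ∀ {w x d} → w ≤ x → D w d → D x d
      V⁺ V⁻    : W → (P : Pred) → Vec Dom (arity P) → Set
      V⁺-in    : ∀ {w P ds} → V⁺ w P ds → All (D w) ds
      V⁻-in    : ∀ {w P ds} → V⁻ w P ds → All (D w) ds
      disjoint : ∀ {w P ds} → V⁺ w P ds → V⁻ w P ds → ⊥
      V⁺-mono  : ∀ {w x P ds} → w ≤ x → V⁺ w P ds → V⁺ x P ds
      V⁻-mono  : ∀ {w x P ds} → w ≤ x → V⁻ w P ds → V⁻ x P ds
      pot-omni : ∀ w P (ds : Vec Dom (arity P)) → All (D w) ds →
                 ∀ x → w ≤ x → Σ W λ y → x ≤ y × (V⁺ y P ds ⊎ V⁻ y P ds)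

    ⟦_⟧t : {n : ℕ} → Term Dom n → Vec Dom n → Dom
    ⟦ var i ⟧t ρ = lookup ρ i
    ⟦ cst c ⟧t ρ = con c
    ⟦ par d ⟧t ρ = d

    ⟦_⟧ts : {n m : ℕ} → Vec (Term Dom n) m → Vec Dom n → Vec Dom m
    ⟦ [] ⟧ts ρ = []
    ⟦ t ∷ ts ⟧ts ρ = ⟦ t ⟧t ρ ∷ ⟦ ts ⟧ts ρ

    -- One w A ρ  :  1 ∈ I(w, A(ρ));   Zero w A ρ  :  0 ∈ I(w, A(ρ)).
    -- ρ gives the values substituted for the free variables of A
    -- (ρ = [] for sentences), so A(d) is represented by A with d ∷ ρ.
    One Zero : {n : ℕ} → W → Form Dom n → Vec Dom n → Set
    One w (atom P ts) ρ = V⁺ w P (⟦ ts ⟧ts ρ)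
    One w ⊥' ρ = ⊥
    One w (∼ A) ρ = Zero w A ρ
    One w (A ∧' B) ρ = One w A ρ × One w B ρ
    One w (A ∨' B) ρ = One w A ρ ⊎ One w B ρ
    One w (A ⇒ B) ρ = ∀ x → w ≤ x → ¬ One x A ρ ⊎ One x B ρ
    One w (all A) ρ = ∀ x → w ≤ x → ∀ d → D x d → One x A (d ∷ ρ)
    One w (ex A) ρ = Σ Dom λ d → D w d × One w A (d ∷ ρ)

    Zero w (atom P ts) ρ = V⁻ w P (⟦ ts ⟧ts ρ)
    Zero w ⊥' ρ = ⊤
    Zero w (∼ A) ρ = One w A ρ
    Zero w (A ∧' B) ρ = Zero w A ρ ⊎ Zero w B ρ
    Zero w (A ∨' B) ρ = Zero w A ρ × Zero w B ρ
    Zero w (A ⇒ B) ρ = (∀ x → w ≤ x → ¬ Zero x A ρ) × Zero w B ρ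
    Zero w (all A) ρ = Σ Dom λ d → D w d × Zero w A (d ∷ ρ)
    Zero w (ex A) ρ = ∀ x → w ≤ x → ∀ d → D x d → Zero x A (d ∷ ρ)

    1∈I 0∈I : W → Sent Dom → Set
    1∈I w A = One w A []
    0∈I w A = Zero w A []

-- Truth and falsity are persistent along ≤, and at a maximal point m the
-- accessible future is {m} alone, so the clauses for → and ∀/∃ collapse to
-- their classical two-valued readings there. By induction on formulas, each
-- formula with parameters in D(m) is then bivalent at m: disjointness and
-- potential omniscience of V± settle atoms, and excluded middle settles the
-- quantifiers. Given w, a maximal successor m ≥ w inherits any glut at w,
-- and a maximal successor of x ≥ w decides every A(d⃗).

module Submission where

open import Defs
open import Axiom.ExcludedMiddle using (ExcludedMiddle)
open import Level using (0ℓ)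
open import Data.Empty using (⊥; ⊥-elim)
open import Data.Unit using (⊤; tt)
open import Data.Product using (Σ; _×_; _,_; proj₁; proj₂)
open import Data.Product.Function.NonDependent.Propositional using (_×-⇔_)
open import Data.Sum using (_⊎_; inj₁; inj₂; [_,_]′)
open import Data.Vec using (Vec; []; _∷_)
open import Data.Vec.Relation.Unary.All as All using (All; []; _∷_)
open import Data.Vec.Relation.Unary.All.Properties using (lookup⁺)
open import Function.Base using (id)
open import Function.Bundles using (_⇔_; mk⇔; Equivalence)
open import Function.Construct.Identity using (⇔-id)
open import Relation.Nullary using (¬_; yes; no)
open import Relation.Binary.PropositionalEquality using (_≡_; subst; sym)

Bivalent : Set → Set → Set
Bivalent T F = ¬ (T × F) × (T ⊎ F)

bivalent-swap : ∀ {T F} → Bivalent T F → Bivalent F T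
bivalent-swap (cons , inj₁ t) = (λ (f , t) → cons (t , f)) , inj₂ t
bivalent-swap (cons , inj₂ f) = (λ (f , t) → cons (t , f)) , inj₁ f

bivalent-⊥ : Bivalent ⊥ ⊤
bivalent-⊥ = (λ ()) , inj₂ tt

bivalent-× : ∀ {T₁ F₁ T₂ F₂} → Bivalent T₁ F₁ → Bivalent T₂ F₂ →
             Bivalent (T₁ × T₂) (F₁ ⊎ F₂)
bivalent-× (cons₁ , _) _ .proj₁ ((t₁ , _) , inj₁ f₁) = cons₁ (t₁ , f₁)
bivalent-× _ (cons₂ , _) .proj₁ ((_ , t₂) , inj₂ f₂) = cons₂ (t₂ , f₂)
bivalent-× (_ , inj₂ f₁) _ .proj₂ = inj₂ (inj₁ f₁)
bivalent-× (_ , inj₁ _) (_ , inj₂ f₂) .proj₂ = inj₂ (inj₂ f₂)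
bivalent-× (_ , inj₁ t₁) (_ , inj₁ t₂) .proj₂ = inj₁ (t₁ , t₂)

bivalent-⊎ : ∀ {T₁ F₁ T₂ F₂} → Bivalent T₁ F₁ → Bivalent T₂ F₂ →
             Bivalent (T₁ ⊎ T₂) (F₁ × F₂)
bivalent-⊎ b₁ b₂ = bivalent-swap (bivalent-× (bivalent-swap b₁) (bivalent-swap b₂))

bivalent-→ : ∀ {T₁ F₁ T₂ F₂} → Bivalent T₁ F₁ → Bivalent T₂ F₂ →
             Bivalent (¬ T₁ ⊎ T₂) (¬ F₁ × F₂)
bivalent-→ _ (cons₂ , _) .proj₁ (inj₂ t₂ , (_ , f₂)) = cons₂ (t₂ , f₂)
bivalent-→ (_ , inj₁ t₁) _ .proj₁ (inj₁ ¬t₁ , _) = ¬t₁ t₁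
bivalent-→ (_ , inj₂ f₁) _ .proj₁ (_ , (¬f₁ , _)) = ¬f₁ f₁
bivalent-→ _ (_ , inj₁ t₂) .proj₂ = inj₁ (inj₂ t₂)
bivalent-→ (cons₁ , inj₁ t₁) (_ , inj₂ f₂) .proj₂ = inj₂ ((λ f₁ → cons₁ (t₁ , f₁)) , f₂)
bivalent-→ (cons₁ , inj₂ f₁) (_ , inj₂ _) .proj₂ = inj₁ (inj₁ (λ t₁ → cons₁ (t₁ , f₁)))

bivalent-∀ : ExcludedMiddle 0ℓ → ∀ {X : Set} {Q T F : X → Set} →
             (∀ d → Q d → Bivalent (T d) (F d)) →
             Bivalent (∀ d → Q d → T d) (Σ X λ d → Q d × F d)
bivalent-∀ lem b .proj₁ (t , (d , q , f)) = proj₁ (b d q) (t d q , f)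
bivalent-∀ lem {X} {Q} {F = F} b .proj₂ with lem {Σ X λ d → Q d × F d}
... | yes counterexample = inj₂ counterexample
... | no none = inj₁ λ d q → [ id , (λ f → ⊥-elim (none (d , q , f))) ]′ (proj₂ (b d q))

bivalent-∃ : ExcludedMiddle 0ℓ → ∀ {X : Set} {Q T F : X → Set} →
             (∀ d → Q d → Bivalent (T d) (F d)) →
             Bivalent (Σ X λ d → Q d × T d) (∀ d → Q d → F d)
bivalent-∃ lem b = bivalent-swap (bivalent-∀ lem λ d q → bivalent-swap (b d q))

bivalent-cong : ∀ {T T′ F F′} → T ⇔ T′ → F ⇔ F′ → Bivalent T F → Bivalent T′ F′
bivalent-cong T⇔T′ F⇔F′ (cons , compl) =
  (λ (t , f) → cons (Equivalence.from T⇔T′ t , Equivalence.from F⇔F′ f)) ,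
  Data.Sum.map (Equivalence.to T⇔T′) (Equivalence.to F⇔F′) compl

module _ (S : Signature) where
  open Signature S

  TermParamsIn-map : ∀ {X : Set} {n} {Q Q′ : X → Set} → (∀ {d} → Q d → Q′ d) →
                     (t : Term S X n) → TermParamsIn S Q t → TermParamsIn S Q′ t
  TermParamsIn-map f (var i) _ = tt
  TermParamsIn-map f (cst c) _ = tt
  TermParamsIn-map f (par d) q = f q

  ParamsIn-map : ∀ {X : Set} {n} {Q Q′ : X → Set} → (∀ {d} → Q d → Q′ d) →
                 (A : Form S X n) → ParamsIn S Q A → ParamsIn S Q′ A
  ParamsIn-map f (atom P ts) p = All.map (λ {t} → TermParamsIn-map f t) p
  ParamsIn-map f ⊥' p = tt
  ParamsIn-map f (∼ A) p = ParamsIn-map f A p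
  ParamsIn-map f (A ∧' B) (p , q) = ParamsIn-map f A p , ParamsIn-map f B q
  ParamsIn-map f (A ∨' B) (p , q) = ParamsIn-map f A p , ParamsIn-map f B q
  ParamsIn-map f (A ⇒ B) (p , q) = ParamsIn-map f A p , ParamsIn-map f B q
  ParamsIn-map f (all A) p = ParamsIn-map f A p
  ParamsIn-map f (ex A) p = ParamsIn-map f A p

  module _ (M : Model S) where
    open Model M

    ⟦⟧ts-in : ∀ {n m} w (ts : Vec (Term S Dom n) m) {ρ : Vec Dom n} →
              All (TermParamsIn S (D w)) ts → All (D w) ρ → All (D w) (⟦ ts ⟧ts ρ)
    ⟦⟧ts-in w [] [] _ = []
    ⟦⟧ts-in w (var i ∷ ts) (_ ∷ ps) r = lookup⁺ r i ∷ ⟦⟧ts-in w ts ps r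
    ⟦⟧ts-in w (cst c ∷ ts) (_ ∷ ps) r = con-in w c ∷ ⟦⟧ts-in w ts ps r
    ⟦⟧ts-in w (par d ∷ ts) (p ∷ ps) r = p ∷ ⟦⟧ts-in w ts ps r

    One-mono  : ∀ {n w x} (A : Form S Dom n) ρ → w ≤ x → One w A ρ → One x A ρ
    Zero-mono : ∀ {n w x} (A : Form S Dom n) ρ → w ≤ x → Zero w A ρ → Zero x A ρ
    One-mono (atom P ts) ρ le o = V⁺-mono le o
    One-mono (∼ A) ρ le o = Zero-mono A ρ le o
    One-mono (A ∧' B) ρ le (a , b) = One-mono A ρ le a , One-mono B ρ le b
    One-mono (A ∨' B) ρ le (inj₁ a) = inj₁ (One-mono A ρ le a)
    One-mono (A ∨' B) ρ le (inj₂ b) = inj₂ (One-mono B ρ le b)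
    One-mono (A ⇒ B) ρ le o = λ y le′ → o y (≤-trans le le′)
    One-mono (all A) ρ le o = λ y le′ → o y (≤-trans le le′)
    One-mono (ex A) ρ le (d , dd , o) = d , D-mono le dd , One-mono A (d ∷ ρ) le o
    Zero-mono (atom P ts) ρ le z = V⁻-mono le z
    Zero-mono ⊥' ρ le z = tt
    Zero-mono (∼ A) ρ le z = One-mono A ρ le z
    Zero-mono (A ∧' B) ρ le (inj₁ a) = inj₁ (Zero-mono A ρ le a)
    Zero-mono (A ∧' B) ρ le (inj₂ b) = inj₂ (Zero-mono B ρ le b)
    Zero-mono (A ∨' B) ρ le (a , b) = Zero-mono A ρ le a , Zero-mono B ρ le b
    Zero-mono (A ⇒ B) ρ le (z , b) = (λ y le′ → z y (≤-trans le le′)) , Zero-mono B ρ le b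
    Zero-mono (all A) ρ le (d , dd , z) = d , D-mono le dd , Zero-mono A (d ∷ ρ) le z
    Zero-mono (ex A) ρ le z = λ y le′ → z y (≤-trans le le′)

    Maximal : W → Set
    Maximal m = ∀ y → m ≤ y → y ≡ m

    module _ {m : W} (max : Maximal m) where

      here⇔everywhere-above : (P : W → Set) → P m ⇔ (∀ y → m ≤ y → P y)
      here⇔everywhere-above P =
        mk⇔ (λ h y le → subst P (sym (max y le)) h) (λ h → h m (≤-refl m))

      bivalent-atom : ∀ P (ds : Vec Dom (arity P)) → All (D m) ds →
                      Bivalent (V⁺ m P ds) (V⁻ m P ds)
      bivalent-atom P ds ds∈D .proj₁ (t , f) = disjoint t f
      bivalent-atom P ds ds∈D .proj₂ with pot-omni m P ds ds∈D m (≤-refl m)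
      ... | y , le , decided = subst (λ y → V⁺ y P ds ⊎ V⁻ y P ds) (max y le) decided

      bivalent-at-maximal : ExcludedMiddle 0ℓ → ∀ {n} (A : Form S Dom n) {ρ : Vec Dom n} →
                            ParamsIn S (D m) A → All (D m) ρ →
                            Bivalent (One m A ρ) (Zero m A ρ)
      bivalent-at-maximal lem (atom P ts) p r = bivalent-atom P _ (⟦⟧ts-in m ts p r)
      bivalent-at-maximal lem ⊥' p r = bivalent-⊥
      bivalent-at-maximal lem (∼ A) p r = bivalent-swap (bivalent-at-maximal lem A p r)
      bivalent-at-maximal lem (A ∧' B) (p , q) r =
        bivalent-× (bivalent-at-maximal lem A p r) (bivalent-at-maximal lem B q r)
      bivalent-at-maximal lem (A ∨' B) (p , q) r =
        bivalent-⊎ (bivalent-at-maximal lem A p r) (bivalent-at-maximal lem B q r)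
      bivalent-at-maximal lem (A ⇒ B) {ρ} (p , q) r =
        bivalent-cong
          (here⇔everywhere-above λ y → ¬ One y A ρ ⊎ One y B ρ)
          (here⇔everywhere-above (λ y → ¬ Zero y A ρ) ×-⇔ ⇔-id _)
          (bivalent-→ (bivalent-at-maximal lem A p r) (bivalent-at-maximal lem B q r))
      bivalent-at-maximal lem (all A) {ρ} p r =
        bivalent-cong
          (here⇔everywhere-above λ y → ∀ d → D y d → One y A (d ∷ ρ))
          (⇔-id _)
          (bivalent-∀ lem λ d d∈D → bivalent-at-maximal lem A p (d∈D ∷ r))
      bivalent-at-maximal lem (ex A) {ρ} p r =
        bivalent-cong
          (⇔-id _)
          (here⇔everywhere-above λ y → ∀ d → D y d → Zero y A (d ∷ ρ))
          (bivalent-∃ lem λ d d∈D → bivalent-at-maximal lem A p (d∈D ∷ r))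

proposition3p2 : ExcludedMiddle 0ℓ → (S : Signature) (M : Model S) →
    let open Model M in
    (w : W) →
    (¬ (Σ (Sent S Dom) λ A → ParamsIn S (D w) A × 1∈I w A × 0∈I w A))
    × ((A : Sent S Dom) → ParamsIn S (D w) A →
    (x : W) → w ≤ x → Σ W λ y → x ≤ y × (1∈I y A ⊎ 0∈I y A))
proposition3p2 lem S M w = no-glut , eventually-decided
  where
  open Model M

  bivalent-above : ∀ {v} (A : Sent S Dom) → ParamsIn S (D v) A →
                   Σ W λ m → v ≤ m × Bivalent (1∈I m A) (0∈I m A)
  bivalent-above {v} A p with maxSucc v
  ... | m , v≤m , max =
    m , v≤m , bivalent-at-maximal S M max lem A (ParamsIn-map S (D-mono v≤m) A p) []

  no-glut : ¬ (Σ (Sent S Dom) λ A → ParamsIn S (D w) A × 1∈I w A × 0∈I w A)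
  no-glut (A , p , t , f) with bivalent-above A p
  ... | m , w≤m , (cons , _) = cons (One-mono S M A [] w≤m t , Zero-mono S M A [] w≤m f)

  eventually-decided : (A : Sent S Dom) → ParamsIn S (D w) A →
                       (x : W) → w ≤ x → Σ W λ y → x ≤ y × (1∈I y A ⊎ 0∈I y A)
  eventually-decided A p x w≤x with bivalent-above A (ParamsIn-map S (D-mono w≤x) A p)
  ... | m , x≤m , (_ , compl) = m , x≤m , compl
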